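{- Let $(a_{0,m})_{m\geq 0}$ be a sequence of complex numbers, and define the infinite matrix $\mathcal{S}=(a_{n,m})_{n,m\geq 0}$ recursively by $$a_{n+1,m}=a_{n,m+1}+m\,a_{n,m}\qquad (n,m\geq 0).$$ Then for all $n,m\geq 0$, $$a_{n,m}=\sum_{k=0}^{n}\genfrac{\{}{\}}{0pt}{}{n+m}{k+m}_{m}a_{0,m+k}.$$
   Context: For an integer $r\geq 0$, the $r$-Stirling numbers of the second kind $\genfrac{\{}{\}}{0pt}{}{n}{k}_{r}$ (the number of partitions of an $n$-element set into exactly $k$ nonempty disjoint blocks such that the first $r$ elements lie in distinct blocks) are defined by: $\genfrac{\{}{\}}{0pt}{}{n}{k}_{r}=0$ for $n<r$; $\genfrac{\{}{\}}{0pt}{}{n}{k}_{r}=\delta_{k,r}$ for $n=r$; and $\genfrac{\{}{\}}{0pt}{}{n}{k}_{r}=k\genfrac{\{}{\}}{0pt}{}{n-1}{k}_{r}+\genfrac{\{}{\}}{0pt}{}{n-1}{k-1}_{r}$ for $n>r$. For $r=0$ these are the ordinary Stirling numbers of the second kind $\genfrac{\{}{\}}{0pt}{}{n}{k}$. -}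

module Defs where

import Data.Nat
open import Data.Nat using (ℕ; zero; suc; _*_; _≡ᵇ_; _≤ᵇ_)
open import Data.Bool using (if_then_else_)
open import Algebra.Bundles using (CommutativeRing)
import Algebra.Definitions.RawMonoid as RawMonoidDefs

-- r-Stirling numbers of the second kind:  rStirling r n k = {n k}_r
--   = 0 for n < r;  = δ_{k,r} for n = r;
--   = k * {n-1, k}_r + {n-1, k-1}_r for n > r  (with {n-1, -1}_r = 0).
rStirling : ℕ → ℕ → ℕ → ℕ
rStirling r zero k = if r ≡ᵇ 0 then (if k ≡ᵇ r then 1 else 0) else 0
rStirling r (suc n) k =
  if suc n ≡ᵇ r then (if k ≡ᵇ r then 1 else 0)
  else (if suc n ≤ᵇ r then 0 else step k)
  where
  step : ℕ → ℕ
  step zero = zero * rStirling r n zero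
  step (suc k′) = suc k′ * rStirling r n (suc k′) Data.Nat.+ rStirling r n k′

module RingOps {c ℓ} (R : CommutativeRing c ℓ) where
  open CommutativeRing R public using (Carrier; _≈_; _+_)
  open CommutativeRing R using (+-rawMonoid)
  open RawMonoidDefs +-rawMonoid public using (_×_)

  sumTo : ℕ → (ℕ → Carrier) → Carrier
  sumTo zero f = f zero
  sumTo (suc n) f = sumTo n f + f (suc n)

-- Both sides of the identity satisfy the recurrence a(n+1, m) = a(n, m+1) + m a(n, m) with the
-- same row n = 0, and such a matrix is determined by its first row.  For the right-hand side the
-- recurrence is the r-Stirling identity {n+1, k}_m = {n+1, k}_(m+1) + m {n, k}_m, together with
-- the vanishing of {n+m, k}_m outside m ≤ k ≤ n+m, which lets the summation range move by one.
module Submission where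

open import Defs
open import Data.Nat using (ℕ; zero; suc; _*_; _<_; _≡ᵇ_; _<ᵇ_; s≤s) renaming (_+_ to _+ℕ_)
open import Algebra.Bundles using (CommutativeRing)
open import Data.Nat.Properties using (*-zeroʳ; +-comm; +-suc; ≤-refl; n<1+n; <-trans; m<n⇒m<1+n; n≮n)
open import Data.Nat.Solver using (module +-*-Solver)
open import Data.Bool using (true; false; if_then_else_)
open import Data.Empty using (⊥-elim)
open import Relation.Binary.PropositionalEquality as ≡ using (_≡_; _≢_; refl; cong; cong₂)
import Algebra.Properties.CommutativeMonoid.Mult as Multiplication
import Algebra.Properties.CommutativeSemigroup as CommutativeSemigroupProperties
import Relation.Binary.Reasoning.Setoid as SetoidReasoning

δ : ℕ → ℕ → ℕ
δ zero    zero    = 1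
δ zero    (suc _) = 0
δ (suc _) zero    = 0
δ (suc i) (suc j) = δ i j

δ-refl : ∀ i → δ i i ≡ 1
δ-refl zero    = refl
δ-refl (suc i) = δ-refl i

δ-≢ : ∀ {i j} → i ≢ j → δ i j ≡ 0
δ-≢ {zero}  {zero}  i≢j = ⊥-elim (i≢j refl)
δ-≢ {zero}  {suc _} _   = refl
δ-≢ {suc _} {zero}  _   = refl
δ-≢ {suc i} {suc j} i≢j = δ-≢ (λ i≡j → i≢j (cong suc i≡j))

*-δ-comm : ∀ i j → i * δ i j ≡ j * δ i j
*-δ-comm zero    zero    = refl
*-δ-comm zero    (suc j) = ≡.sym (*-zeroʳ (suc j))
*-δ-comm (suc i) zero    = *-zeroʳ (suc i)
*-δ-comm (suc i) (suc j) = cong (δ i j +ℕ_) (*-δ-comm i j)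

-- S r d k = {d + r, k}_r: indexing by the excess d = n − r makes the defining recursion structural.
S : ℕ → ℕ → ℕ → ℕ
S r zero    k       = δ k r
S r (suc d) zero    = 0
S r (suc d) (suc k) = suc k * S r d (suc k) +ℕ S r d k

S-below : ∀ {r} d {k} → k < r → S r d k ≡ 0
S-below {r} zero    {k}     k<r = δ-≢ {k} {r} (λ { refl → n≮n k k<r })
S-below     (suc d) {zero}  k<r = refl
S-below     (suc d) {suc k} k<r
  rewrite S-below d k<r | S-below d (<-trans (n<1+n k) k<r) | *-zeroʳ k = refl

S-above : ∀ {r} d {k} → d +ℕ r < k → S r d k ≡ 0
S-above {r} zero    {k}     r<k         = δ-≢ {k} {r} (λ { refl → n≮n k r<k })
S-above     (suc d) {suc k} (s≤s d+r<k)
  rewrite S-above d (m<n⇒m<1+n d+r<k) | S-above d d+r<k | *-zeroʳ k = refl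

-- {n+1, k}_m = {n+1, k}_(m+1) + m {n, k}_m: the element m+1 is either alone among the first
-- m+1 elements in its block, or it joins the block of one of the first m.
S-suc-excess : ∀ d m k → S m (suc d) k ≡ S (suc m) d k +ℕ m * S m d k
S-suc-excess zero    m zero    = *-δ-comm zero m
S-suc-excess zero    m (suc k) =
  ≡.trans (cong (_+ℕ δ k m) (*-δ-comm (suc k) m)) (+-comm (m * δ (suc k) m) (δ k m))
S-suc-excess (suc d) m zero    = ≡.sym (*-zeroʳ m)
S-suc-excess (suc d) m (suc k) =
  ≡.trans (cong₂ (λ u v → suc k * u +ℕ v) (S-suc-excess d m (suc k)) (S-suc-excess d m k))
          (solve 6 (λ K A B C D M → (con 1 :+ K) :* (A :+ M :* B) :+ (C :+ M :* D)
                                 := ((con 1 :+ K) :* A :+ C) :+ M :* ((con 1 :+ K) :* B :+ D))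
                   refl k (S (suc m) d (suc k)) (S m d (suc k)) (S (suc m) d k) (S m d k) m)
  where open +-*-Solver

≡ᵇ-refl : ∀ n → (n ≡ᵇ n) ≡ true
≡ᵇ-refl zero    = refl
≡ᵇ-refl (suc n) = ≡ᵇ-refl n

indicator≡δ : ∀ k r → (if k ≡ᵇ r then 1 else 0) ≡ δ k r
indicator≡δ zero    zero    = refl
indicator≡δ zero    (suc r) = refl
indicator≡δ (suc k) zero    = refl
indicator≡δ (suc k) (suc r) = indicator≡δ k r

1+d+r≡ᵇr : ∀ d r → (suc (d +ℕ r) ≡ᵇ r) ≡ false
1+d+r≡ᵇr d zero    = refl
1+d+r≡ᵇr d (suc r) rewrite +-suc d r = 1+d+r≡ᵇr d r

d+r<ᵇr : ∀ d r → (d +ℕ r <ᵇ r) ≡ false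
d+r<ᵇr d zero    = refl
d+r<ᵇr d (suc r) rewrite +-suc d r = d+r<ᵇr d r

rStirling≡S : ∀ d r k → rStirling r (d +ℕ r) k ≡ S r d k
rStirling≡S zero    zero    k = indicator≡δ k zero
rStirling≡S zero    (suc r) k rewrite ≡ᵇ-refl r = indicator≡δ k (suc r)
rStirling≡S (suc d) r zero    rewrite 1+d+r≡ᵇr d r | d+r<ᵇr d r = refl
rStirling≡S (suc d) r (suc k)
  rewrite 1+d+r≡ᵇr d r | d+r<ᵇr d r | rStirling≡S d r (suc k) | rStirling≡S d r k = refl

module Transform {c ℓ} (R : CommutativeRing c ℓ) where
  open RingOps R
  open CommutativeRing R
    renaming (refl to ≈-refl)
    using (0#; +-cong; +-assoc; +-identityˡ; +-identityʳ; +-commutativeMonoid; +-commutativeSemigroup;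
           setoid; sym; trans; reflexive)
  open Multiplication +-commutativeMonoid using (×-congʳ; ×-congˡ; ×-homo-1; ×-homo-+; ×-assocˡ; ×-distrib-+)
  open CommutativeSemigroupProperties +-commutativeSemigroup using (interchange; x∙yz≈y∙xz)
  open SetoidReasoning setoid

  sumTo-cong : ∀ n {f g : ℕ → Carrier} → (∀ k → f k ≈ g k) → sumTo n f ≈ sumTo n g
  sumTo-cong zero    f≈g = f≈g zero
  sumTo-cong (suc n) f≈g = +-cong (sumTo-cong n f≈g) (f≈g (suc n))

  sumTo-+ : ∀ n f g → sumTo n (λ k → f k + g k) ≈ sumTo n f + sumTo n g
  sumTo-+ zero    f g = ≈-refl
  sumTo-+ (suc n) f g = trans (+-cong (sumTo-+ n f g) ≈-refl) (interchange _ _ _ _)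

  ×-sumTo : ∀ m n f → m × sumTo n f ≈ sumTo n (λ k → m × f k)
  ×-sumTo m zero    f = ≈-refl
  ×-sumTo m (suc n) f = trans (×-distrib-+ _ _ m) (+-cong (×-sumTo m n f) ≈-refl)

  sumTo-suc : ∀ n f → sumTo (suc n) f ≈ f 0 + sumTo n (λ k → f (suc k))
  sumTo-suc zero    f = ≈-refl
  sumTo-suc (suc n) f = trans (+-cong (sumTo-suc n f) ≈-refl) (+-assoc _ _ _)

  sumTo-suc-last≈0 : ∀ n f → f (suc n) ≈ 0# → sumTo (suc n) f ≈ sumTo n f
  sumTo-suc-last≈0 n f last≈0 = trans (+-cong ≈-refl last≈0) (+-identityʳ _)

  Recurrence : (ℕ → ℕ → Carrier) → Set ℓ
  Recurrence a = ∀ n m → a (suc n) m ≈ (a n (suc m) + m × a n m)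

  recurrence-unique : ∀ {a b} → Recurrence a → Recurrence b →
                      (∀ m → a 0 m ≈ b 0 m) → ∀ n m → a n m ≈ b n m
  recurrence-unique         ra rb a₀≈b₀ zero    m = a₀≈b₀ m
  recurrence-unique {a} {b} ra rb a₀≈b₀ (suc n) m = begin
    a (suc n) m             ≈⟨ ra n m ⟩
    a n (suc m) + m × a n m ≈⟨ +-cong (a≈b n (suc m)) (×-congʳ m (a≈b n m)) ⟩
    b n (suc m) + m × b n m ≈⟨ sym (rb n m) ⟩
    b (suc n) m             ∎
    where a≈b = recurrence-unique ra rb a₀≈b₀

  module _ (x : ℕ → Carrier) where

    stirlingTerm : ℕ → ℕ → ℕ → Carrier
    stirlingTerm n m i = S m n i × x i

    stirlingTransform : ℕ → ℕ → Carrier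
    stirlingTransform n m = sumTo n (λ k → stirlingTerm n m (k +ℕ m))

    stirlingTerm-suc : ∀ n m i →
                       stirlingTerm (suc n) m i ≈ stirlingTerm n (suc m) i + m × stirlingTerm n m i
    stirlingTerm-suc n m i = begin
      S m (suc n) i × x i                       ≈⟨ ×-congˡ (S-suc-excess n m i) ⟩
      (S (suc m) n i +ℕ m * S m n i) × x i      ≈⟨ ×-homo-+ (x i) (S (suc m) n i) (m * S m n i) ⟩
      S (suc m) n i × x i + (m * S m n i) × x i ≈⟨ +-cong ≈-refl (sym (×-assocˡ (x i) m _)) ⟩
      stirlingTerm n (suc m) i + m × stirlingTerm n m i ∎

    stirlingTerm-first : ∀ n m → stirlingTerm (suc n) m m ≈ m × stirlingTerm n m m
    stirlingTerm-first n m = begin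
      stirlingTerm (suc n) m m
        ≈⟨ stirlingTerm-suc n m m ⟩
      stirlingTerm n (suc m) m + m × stirlingTerm n m m
        ≈⟨ +-cong (×-congˡ (S-below n (n<1+n m))) ≈-refl ⟩
      0# + m × stirlingTerm n m m
        ≈⟨ +-identityˡ _ ⟩
      m × stirlingTerm n m m ∎

    stirlingTerm-shifted : ∀ n m k → stirlingTerm (suc n) m (suc k +ℕ m) ≈
                           stirlingTerm n (suc m) (k +ℕ suc m) + m × stirlingTerm n m (suc k +ℕ m)
    stirlingTerm-shifted n m k = trans (stirlingTerm-suc n m (suc k +ℕ m))
      (+-cong (reflexive (cong (stirlingTerm n (suc m)) (≡.sym (+-suc k m)))) ≈-refl)

    stirlingTerm-last : ∀ n m → stirlingTerm n m (suc n +ℕ m) ≈ 0#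
    stirlingTerm-last n m = ×-congˡ (S-above n ≤-refl)

    stirlingTransform-zero : ∀ m → stirlingTransform 0 m ≈ x m
    stirlingTransform-zero m = trans (×-congˡ (δ-refl m)) (×-homo-1 (x m))

    stirlingTransform-recurrence : Recurrence stirlingTransform
    stirlingTransform-recurrence n m = begin
      sumTo (suc n) (λ k → stirlingTerm (suc n) m (k +ℕ m))
        ≈⟨ sumTo-suc n _ ⟩
      stirlingTerm (suc n) m m + sumTo n (λ k → stirlingTerm (suc n) m (suc k +ℕ m))
        ≈⟨ +-cong (stirlingTerm-first n m) (sumTo-cong n (stirlingTerm-shifted n m)) ⟩
      m × f 0 + sumTo n (λ k → g k + m × f (suc k))
        ≈⟨ +-cong ≈-refl (trans (sumTo-+ n g _) (+-cong ≈-refl (sym (×-sumTo m n _)))) ⟩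
      m × f 0 + (sumTo n g + m × sumTo n (λ k → f (suc k)))
        ≈⟨ x∙yz≈y∙xz _ _ _ ⟩
      sumTo n g + (m × f 0 + m × sumTo n (λ k → f (suc k)))
        ≈⟨ +-cong ≈-refl (sym (×-distrib-+ _ _ m)) ⟩
      sumTo n g + m × (f 0 + sumTo n (λ k → f (suc k)))
        ≈⟨ +-cong ≈-refl (×-congʳ m (sym (sumTo-suc n f))) ⟩
      sumTo n g + m × sumTo (suc n) f
        ≈⟨ +-cong ≈-refl (×-congʳ m (sumTo-suc-last≈0 n f (stirlingTerm-last n m))) ⟩
      sumTo n g + m × sumTo n f ∎
      where
      f g : ℕ → Carrier
      f k = stirlingTerm n m (k +ℕ m)
      g k = stirlingTerm n (suc m) (k +ℕ suc m)

theorem1 : ∀ {c ℓ} (R : CommutativeRing c ℓ) →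
    let open RingOps R in
    (a : ℕ → ℕ → Carrier) →
    (∀ n m → a (suc n) m ≈ (a n (suc m) + m × a n m)) →
    ∀ n m → a n m ≈ sumTo n (λ k → rStirling m (n +ℕ m) (k +ℕ m) × a 0 (m +ℕ k))
theorem1 R a rec n m = begin
  a n m
    ≈⟨ recurrence-unique rec (stirlingTransform-recurrence x) (λ m → sym (stirlingTransform-zero x m)) n m ⟩
  stirlingTransform x n m
    ≈⟨ sumTo-cong n (λ k → ×-cong (≡.sym (rStirling≡S n m (k +ℕ m))) (reflexive (cong x (+-comm k m)))) ⟩
  sumTo n (λ k → rStirling m (n +ℕ m) (k +ℕ m) × x (m +ℕ k)) ∎
  where
  open RingOps R
  open Transform R
  open CommutativeRing R using (setoid; sym; reflexive; +-commutativeMonoid)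
  open Multiplication +-commutativeMonoid using (×-cong)
  open SetoidReasoning setoid

  x : ℕ → Carrier
  x = a 0
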